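{- Let $G,H$ be well-tempered scoring games. Then $\psi^+(G+H)=\psi^+(G)+\psi^+(H)$ and $\psi^-(G+H)=\psi^-(G)+\psi^-(H)$, as partizan game values.
   Context: A well-tempered scoring game is defined recursively: an even-tempered game is either an integer or a pair $\{G^L|G^R\}$ with finite nonempty sets of odd-tempered left and right options; an odd-tempered game is a pair $\{G^L|G^R\}$ with finite nonempty sets of even-tempered options. Integers have no options. Disjunctive sum of scoring games: integer sum if both are integers, else $G+H=\{G^L+H,G+H^L\mid G^R+H,G+H^R\}$. For normal-play partizan games, $\{G^L_1,\dots|G^R_1,\dots\}_+$ (resp. $\{\cdots\}_-$) denotes the usual partizan game $\{G^L_1,\dots|G^R_1,\dots\}$ unless there is at least one integer $n$ with $G^L_i\lhd n\lhd G^R_j$ for all $i,j$, in which case it denotes the largest (resp. smallest) such integer; here $\lhd$ means "less than or confused with". The maps $\psi^\pm$ from scoring games to partizan games: $\psi^\pm(n)=n$ for integers and $\psi^\pm(\{G^L|G^R\})=\{\psi^\pm(G^L)|\psi^\pm(G^R)\}_\pm$. -}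

module Defs where

open import Data.Bool using (Bool; true; false; _∧_; _∨_; T)
open import Data.Nat using (ℕ; zero; suc; _⊔_) renaming (_+_ to _+ℕ_; _*_ to _*ℕ_)
open import Data.Integer using (ℤ; +_; -[1+_]; -_; _-_) renaming (_+_ to _+ℤ_)
open import Data.Fin using (Fin; zero; suc; splitAt)
open import Data.Sum using (inj₁; inj₂; [_,_]′)
open import Data.List using (List; []; _∷_; map; upTo)
open import Data.Maybe using (Maybe; just; nothing)
open import Data.Product using (_×_; Σ)

allF : (n : ℕ) → (Fin n → Bool) → Bool
allF zero    f = true
allF (suc n) f = f zero ∧ allF n (λ i → f (suc i))

anyF : (n : ℕ) → (Fin n → Bool) → Bool
anyF zero    f = false
anyF (suc n) f = f zero ∨ anyF n (λ i → f (suc i))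

maxF : (n : ℕ) → (Fin n → ℕ) → ℕ
maxF zero    f = 0
maxF (suc n) f = f zero ⊔ maxF n (λ i → f (suc i))

concatF : {A : Set} (a b : ℕ) → (Fin a → A) → (Fin b → A) → Fin (a +ℕ b) → A
concatF a b f g k = [ f , g ]′ (splitAt a k)

data PG : Set where
  mk : (nL : ℕ) → (Fin nL → PG) → (nR : ℕ) → (Fin nR → PG) → PG

-- Conway's order:  G ≤ H  iff no G^L with H ≤ G^L and no H^R with H^R ≤ G;
-- G ⧏ H ("less than or confused with") iff some H^L with G ≤ H^L or some
-- G^R with G^R ≤ H  (equivalently: not H ≤ G).
mutual
  leB : PG → PG → Bool
  leB G@(mk a L b R) H@(mk c L' d R') =
    allF a (λ i → lfB (L i) H) ∧ allF d (λ j → lfB G (R' j))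

  lfB : PG → PG → Bool
  lfB G@(mk a L b R) H@(mk c L' d R') =
    anyF c (λ i → leB G (L' i)) ∨ anyF b (λ j → leB (R j) H)

_≤ᵖ_ : PG → PG → Set
G ≤ᵖ H = T (leB G H)

_⧏ᵖ_ : PG → PG → Set
G ⧏ᵖ H = T (lfB G H)

_≈ᵖ_ : PG → PG → Set
G ≈ᵖ H = (G ≤ᵖ H) × (H ≤ᵖ G)

_+ᵖ_ : PG → PG → PG
G@(mk a L b R) +ᵖ H@(mk c L' d R') =
  mk (a +ℕ c) (concatF a c (λ i → L i +ᵖ H) (λ i → G +ᵖ L' i))
     (b +ℕ d) (concatF b d (λ j → R j +ᵖ H) (λ j → G +ᵖ R' j))

emptyF : {A : Set} → Fin 0 → A
emptyF ()

zeroᵖ : PG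
zeroᵖ = mk 0 emptyF 0 emptyF

intᵖ : ℤ → PG
intᵖ (+ zero)          = zeroᵖ
intᵖ (+ suc n)         = mk 1 (λ _ → intᵖ (+ n)) 0 emptyF
intᵖ -[1+ zero ]       = mk 0 emptyF 1 (λ _ → zeroᵖ)
intᵖ -[1+ suc n ]      = mk 0 emptyF 1 (λ _ → intᵖ -[1+ n ])

-- An upper bound on the birthday of a game (every game born by day b
-- satisfies -b ≤ G ≤ b).
rank : PG → ℕ
rank (mk a L b R) = suc (maxF a (λ i → rank (L i)) ⊔ maxF b (λ j → rank (R j)))

-- If there is an integer n with G^L_i ⧏ n ⧏ G^R_j for all i, j, the result
-- is the largest (+) / smallest (-) such n; otherwise the usual game.
-- When both option sets are nonempty (the only case arising from
-- well-tempered scoring games), every such n satisfies |n| ≤ B where B is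
-- the maximal rank of the options, so a search of [-B, B] is exhaustive.

firstSuch : (ℤ → Bool) → List ℤ → Maybe ℤ
firstSuch p []       = nothing
firstSuch p (x ∷ xs) with p x
... | true  = just x
... | false = firstSuch p xs

between : (nL : ℕ) → (Fin nL → PG) → (nR : ℕ) → (Fin nR → PG) → ℤ → Bool
between a L b R n = allF a (λ i → lfB (L i) (intᵖ n)) ∧ allF b (λ j → lfB (intᵖ n) (R j))

optBound : (nL : ℕ) → (Fin nL → PG) → (nR : ℕ) → (Fin nR → PG) → ℕ
optBound a L b R = maxF a (λ i → rank (L i)) ⊔ maxF b (λ j → rank (R j))

descending : ℕ → List ℤ
descending B = map (λ k → + B - + k) (upTo (suc (2 *ℕ B)))

ascending : ℕ → List ℤ
ascending B = map (λ k → (- + B) +ℤ + k) (upTo (suc (2 *ℕ B)))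

orGame : Maybe ℤ → PG → PG
orGame (just n) _ = intᵖ n
orGame nothing  G = G

brace⁺ : (nL : ℕ) → (Fin nL → PG) → (nR : ℕ) → (Fin nR → PG) → PG
brace⁺ a L b R =
  orGame (firstSuch (between a L b R) (descending (optBound a L b R))) (mk a L b R)

brace⁻ : (nL : ℕ) → (Fin nL → PG) → (nR : ℕ) → (Fin nR → PG) → PG
brace⁻ a L b R =
  orGame (firstSuch (between a L b R) (ascending (optBound a L b R))) (mk a L b R)

data SG : Set where
  num : ℤ → SG
  opt : (nL : ℕ) → (Fin nL → SG) → (nR : ℕ) → (Fin nR → SG) → SG

mutual
  data EvenT : SG → Set where
    evNum : (n : ℤ) → EvenT (num n)
    evOpt : (a b : ℕ) (L : Fin (suc a) → SG) (R : Fin (suc b) → SG) →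
            (∀ i → OddT (L i)) → (∀ j → OddT (R j)) →
            EvenT (opt (suc a) L (suc b) R)

  data OddT : SG → Set where
    odOpt : (a b : ℕ) (L : Fin (suc a) → SG) (R : Fin (suc b) → SG) →
            (∀ i → EvenT (L i)) → (∀ j → EvenT (R j)) →
            OddT (opt (suc a) L (suc b) R)

data WellTempered (G : SG) : Set where
  even : EvenT G → WellTempered G
  odd  : OddT G → WellTempered G

_+ˢ_ : SG → SG → SG
num m +ˢ num n = num (m +ℤ n)
num m +ˢ H@(opt c L' d R') =
  opt c (λ i → num m +ˢ L' i) d (λ j → num m +ˢ R' j)
G@(opt a L b R) +ˢ num n =
  opt a (λ i → L i +ˢ num n) b (λ j → R j +ˢ num n)
G@(opt a L b R) +ˢ H@(opt c L' d R') =
  opt (a +ℕ c) (concatF a c (λ i → L i +ˢ H) (λ i → G +ˢ L' i))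
      (b +ℕ d) (concatF b d (λ j → R j +ˢ H) (λ j → G +ˢ R' j))

ψ⁺ : SG → PG
ψ⁺ (num n)       = intᵖ n
ψ⁺ (opt a L b R) = brace⁺ a (λ i → ψ⁺ (L i)) b (λ j → ψ⁺ (R j))

ψ⁻ : SG → PG
ψ⁻ (num n)       = intᵖ n
ψ⁻ (opt a L b R) = brace⁻ a (λ i → ψ⁻ (L i)) b (λ j → ψ⁻ (R j))

{-# OPTIONS --safe #-}
-- By induction on G and H
-- the options of ψ(G + H) equal ψ Gᴸ + ψ H, ψ G + ψ Hᴸ, ..., so it remains to
-- compare the brace of these with ψ G + ψ H, by cases on which of ψ G, ψ H and
-- ψ(G + H) collapse to an integer.  Three facts settle the cases.  Adding an
-- integer m shifts the integers between the options by m, so collapses match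
-- up and the extremal integers add.  A game X with no integer between its
-- options has some Xᴿ ≤ X + 1 and some Xᴸ with X ≤ Xᴸ + 1, hence m + X equals
-- {m + Xᴸ | m + Xᴿ}.  If neither A nor B has an integer between its options
-- but A + B has one, A + B equals it.  Well-temperedness is used only to know
-- that all option sets are nonempty: this bounds the integers between the
-- options and so makes the finite search performed by ψ± exhaustive.
module Submission where

open import Defs
open import Algebra.Bundles using (CommutativeMonoid)
open import Data.Bool using (Bool; true; false; T)
open import Data.Bool.Properties using (T?; T-∧; T-∨)
open import Data.Empty using (⊥; ⊥-elim)
open import Data.Fin using (Fin; zero; suc; splitAt; _↑ˡ_; _↑ʳ_)
open import Data.Fin.Properties using (splitAt-↑ˡ; splitAt-↑ʳ)
open import Data.Integer as ℤ using (ℤ; +_; -[1+_]; pred; _+_; _-_; -_; +≤+; -≤+; -≤-; +<+; -<+)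
  renaming (suc to sucℤ)
import Data.Integer.Properties as ℤ
open import Data.Integer.Tactic.RingSolver using (solve-∀)
open import Data.List using (applyUpTo)
open import Data.List.Properties using (map-applyUpTo)
open import Data.Maybe using (Maybe; just; nothing)
open import Data.Nat as ℕ using (ℕ; zero; suc; _⊔_; _*_; s≤s; z≤n)
import Data.Nat.Properties as ℕ
open import Data.Product using (_×_; ∃; _,_; proj₁; proj₂)
open import Data.Sum using (_⊎_; inj₁; inj₂; [_,_]′)
open import Data.Unit using (tt)
open import Function using (_∘_; id; flip; Equivalence)
open import Relation.Binary.Bundles using (Poset)
open import Relation.Binary.Structures using (IsEquivalence)
open import Relation.Binary.PropositionalEquality using (_≡_; refl; sym; trans; cong; subst)
import Relation.Binary.Reasoning.PartialOrder
open import Relation.Nullary using (¬_; Dec; yes; no; map′)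
open import Relation.Nullary.Decidable using (¬?; decidable-stable)
open import Relation.Unary using (Pred; Decidable)

open Equivalence using (to; from)

-- Conway's order

allF⁺ : ∀ n {f : Fin n → Bool} → (∀ i → T (f i)) → T (allF n f)
allF⁺ zero    h = tt
allF⁺ (suc n) h = from T-∧ (h zero , allF⁺ n (h ∘ suc))

allF⁻ : ∀ n {f : Fin n → Bool} → T (allF n f) → ∀ i → T (f i)
allF⁻ (suc n) p zero    = proj₁ (to T-∧ p)
allF⁻ (suc n) p (suc i) = allF⁻ n (proj₂ (to T-∧ p)) i

anyF⁺ : ∀ n {f : Fin n → Bool} i → T (f i) → T (anyF n f)
anyF⁺ (suc n) zero    p = from T-∨ (inj₁ p)
anyF⁺ (suc n) (suc i) p = from T-∨ (inj₂ (anyF⁺ n i p))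

anyF⁻ : ∀ n {f : Fin n → Bool} → T (anyF n f) → ∃ λ i → T (f i)
anyF⁻ (suc n) p with to T-∨ p
... | inj₁ q = zero , q
... | inj₂ q with anyF⁻ n q
...   | i , r = suc i , r

infix 4 _≤_ _⧏_ _≈_

-- Records, because a proof of T (leB G H) does not determine G and H.
record _≤_ (G H : PG) : Set where
  constructor ≤ᵖ⇒≤
  field ≤⇒≤ᵖ : G ≤ᵖ H

record _⧏_ (G H : PG) : Set where
  constructor ⧏ᵖ⇒⧏
  field ⧏⇒⧏ᵖ : G ⧏ᵖ H

open _≤_ public
open _⧏_ public

#left #right : PG → ℕ
#left  (mk a _ _ _) = a
#right (mk _ _ b _) = b

left : (G : PG) → Fin (#left G) → PG
left (mk _ L _ _) = L

right : (G : PG) → Fin (#right G) → PG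
right (mk _ _ _ R) = R

≤-intro : ∀ {G H} → (∀ i → left G i ⧏ H) → (∀ j → G ⧏ right H j) → G ≤ H
≤-intro {mk a _ _ _} {mk _ _ d _} L⧏ ⧏R =
  ≤ᵖ⇒≤ (from T-∧ (allF⁺ a (⧏⇒⧏ᵖ ∘ L⧏) , allF⁺ d (⧏⇒⧏ᵖ ∘ ⧏R)))

≤⇒left⧏ : ∀ {G H} → G ≤ H → ∀ i → left G i ⧏ H
≤⇒left⧏ {mk a _ _ _} {mk _ _ _ _} (≤ᵖ⇒≤ p) i = ⧏ᵖ⇒⧏ (allF⁻ a (proj₁ (to T-∧ p)) i)

≤⇒⧏right : ∀ {G H} → G ≤ H → ∀ j → G ⧏ right H j
≤⇒⧏right {mk _ _ _ _} {mk _ _ d _} (≤ᵖ⇒≤ p) j = ⧏ᵖ⇒⧏ (allF⁻ d (proj₂ (to T-∧ p)) j)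

⧏-introˡ : ∀ {G H} i → G ≤ left H i → G ⧏ H
⧏-introˡ {mk _ _ _ _} {mk c _ _ _} i (≤ᵖ⇒≤ p) = ⧏ᵖ⇒⧏ (from T-∨ (inj₁ (anyF⁺ c i p)))

⧏-introʳ : ∀ {G H} j → right G j ≤ H → G ⧏ H
⧏-introʳ {mk _ _ b _} {mk _ _ _ _} j (≤ᵖ⇒≤ p) = ⧏ᵖ⇒⧏ (from T-∨ (inj₂ (anyF⁺ b j p)))

⧏-elim : ∀ {G H} → G ⧏ H →
         (∃ λ i → G ≤ left H i) ⊎ (∃ λ j → right G j ≤ H)
⧏-elim {mk _ _ b _} {mk c _ _ _} (⧏ᵖ⇒⧏ p) with to T-∨ p
... | inj₁ q = let i , r = anyF⁻ c q in inj₁ (i , ≤ᵖ⇒≤ r)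
... | inj₂ q = let j , r = anyF⁻ b q in inj₂ (j , ≤ᵖ⇒≤ r)

≤-refl : ∀ {G} → G ≤ G
≤-refl {mk _ L _ R} =
  ≤-intro (λ i → ⧏-introˡ i (≤-refl {L i})) (λ j → ⧏-introʳ j (≤-refl {R j}))

left⧏ : ∀ G i → left G i ⧏ G
left⧏ G = ≤⇒left⧏ (≤-refl {G})

⧏right : ∀ G j → G ⧏ right G j
⧏right G = ≤⇒⧏right (≤-refl {G})

mutual
  ≤-trans : ∀ {X Y Z} → X ≤ Y → Y ≤ Z → X ≤ Z
  ≤-trans {X@(mk _ L _ _)} {Y} {Z@(mk _ _ _ R)} X≤Y Y≤Z =
    ≤-intro (λ i → ⧏-≤-trans {L i} {Y} {Z} (≤⇒left⧏ X≤Y i) Y≤Z)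
            (λ j → ≤-⧏-trans {X} {Y} {R j} X≤Y (≤⇒⧏right Y≤Z j))

  ≤-⧏-trans : ∀ {X Y Z} → X ≤ Y → Y ⧏ Z → X ⧏ Z
  ≤-⧏-trans {X} {Y} {Z} X≤Y Y⧏Z = ≤-⧏-cases {X} {Y} {Z} X≤Y (⧏-elim Y⧏Z)

  ≤-⧏-cases : ∀ {X Y Z} → X ≤ Y →
              (∃ λ i → Y ≤ left Z i) ⊎ (∃ λ j → right Y j ≤ Z) → X ⧏ Z
  ≤-⧏-cases {X} {Y} {mk _ L _ _} X≤Y (inj₁ (i , Y≤Zᴸ)) =
    ⧏-introˡ i (≤-trans {X} {Y} {L i} X≤Y Y≤Zᴸ)
  ≤-⧏-cases {X} {mk _ _ _ R} {Z} X≤Y (inj₂ (j , Yᴿ≤Z)) =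
    ⧏-≤-trans {X} {R j} {Z} (≤⇒⧏right X≤Y j) Yᴿ≤Z

  ⧏-≤-trans : ∀ {X Y Z} → X ⧏ Y → Y ≤ Z → X ⧏ Z
  ⧏-≤-trans {X} {Y} {Z} X⧏Y Y≤Z = ⧏-≤-cases {X} {Y} {Z} (⧏-elim X⧏Y) Y≤Z

  ⧏-≤-cases : ∀ {X Y Z} → (∃ λ i → X ≤ left Y i) ⊎ (∃ λ j → right X j ≤ Y) →
              Y ≤ Z → X ⧏ Z
  ⧏-≤-cases {X} {mk _ L _ _} {Z} (inj₁ (i , X≤Yᴸ)) Y≤Z =
    ≤-⧏-trans {X} {L i} {Z} X≤Yᴸ (≤⇒left⧏ Y≤Z i)
  ⧏-≤-cases {mk _ _ _ R} {Y} {Z} (inj₂ (j , Xᴿ≤Y)) Y≤Z =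
    ⧏-introʳ j (≤-trans {R j} {Y} {Z} Xᴿ≤Y Y≤Z)

⧏-irrefl : ∀ {G} → ¬ G ⧏ G
⧏-irrefl {G} G⧏G = irrefl-cases {G} (⧏-elim G⧏G)
  where
  irrefl-cases : ∀ {G} → (∃ λ i → G ≤ left G i) ⊎ (∃ λ j → right G j ≤ G) → ⊥
  irrefl-cases {mk _ L _ _} (inj₁ (i , G≤Gᴸ)) = ⧏-irrefl {L i} (≤⇒left⧏ G≤Gᴸ i)
  irrefl-cases {mk _ _ _ R} (inj₂ (j , Gᴿ≤G)) = ⧏-irrefl {R j} (≤⇒⧏right Gᴿ≤G j)

⧏⇒≱ : ∀ {G H} → G ⧏ H → ¬ H ≤ G
⧏⇒≱ G⧏H H≤G = ⧏-irrefl (⧏-≤-trans G⧏H H≤G)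

_≤?_ : ∀ G H → Dec (G ≤ H)
G ≤? H = map′ ≤ᵖ⇒≤ ≤⇒≤ᵖ (T? (leB G H))

_⧏?_ : ∀ G H → Dec (G ⧏ H)
G ⧏? H = map′ ⧏ᵖ⇒⧏ ⧏⇒⧏ᵖ (T? (lfB G H))

⧏̸⇒≥ : ∀ {G H} → ¬ G ⧏ H → H ≤ G
⧏̸⇒≥ {G@(mk _ _ _ R)} {H@(mk _ L _ _)} G⧏̸H =
  ≤-intro (λ i → decidable-stable (L i ⧏? G) (λ Hᴸ⧏̸G → G⧏̸H (⧏-introˡ i (⧏̸⇒≥ {L i} {G} Hᴸ⧏̸G))))
          (λ j → decidable-stable (H ⧏? R j) (λ H⧏̸Gᴿ → G⧏̸H (⧏-introʳ j (⧏̸⇒≥ {H} {R j} H⧏̸Gᴿ))))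

≱⇒⧏ : ∀ {G H} → ¬ H ≤ G → G ⧏ H
≱⇒⧏ H≰G = decidable-stable (_ ⧏? _) (H≰G ∘ ⧏̸⇒≥)

_≈_ : PG → PG → Set
G ≈ H = G ≤ H × H ≤ G

≈-isEquivalence : IsEquivalence _≈_
≈-isEquivalence = record
  { refl  = ≤-refl , ≤-refl
  ; sym   = λ (p , q) → q , p
  ; trans = λ (p , q) (r , s) → ≤-trans p r , ≤-trans s q
  }

≤-poset : Poset _ _ _
≤-poset = record
  { isPartialOrder = record
    { isPreorder = record
      { isEquivalence = ≈-isEquivalence
      ; reflexive     = proj₁
      ; trans         = ≤-trans
      }
    ; antisym = _,_
    }
  }

open IsEquivalence ≈-isEquivalence public
  using () renaming (refl to ≈-refl; reflexive to ≈-reflexive; sym to ≈-sym; trans to ≈-trans)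

⧏-resp-≈ : ∀ {X X′ Y Y′} → X ≈ X′ → Y ≈ Y′ → X ⧏ Y → X′ ⧏ Y′
⧏-resp-≈ (_ , X′≤X) (Y≤Y′ , _) X⧏Y = ≤-⧏-trans X′≤X (⧏-≤-trans X⧏Y Y≤Y′)

mk-cong : ∀ {a b} {L L′ : Fin a → PG} {R R′ : Fin b → PG} →
          (∀ i → L i ≈ L′ i) → (∀ j → R j ≈ R′ j) → mk a L b R ≈ mk a L′ b R′
mk-cong {L = L} {L′} {R} {R′} L≈L′ R≈R′ =
  ≤-intro (λ i → ≤-⧏-trans (proj₁ (L≈L′ i)) (left⧏ (mk _ L′ _ R′) i))
          (λ j → ⧏-≤-trans (⧏right (mk _ L _ R) j) (proj₁ (R≈R′ j))) ,
  ≤-intro (λ i → ≤-⧏-trans (proj₂ (L≈L′ i)) (left⧏ (mk _ L _ R) i))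
          (λ j → ⧏-≤-trans (⧏right (mk _ L′ _ R′) j) (proj₂ (R≈R′ j)))

≈⇒≈ᵖ : ∀ {G H} → G ≈ H → G ≈ᵖ H
≈⇒≈ᵖ (G≤H , H≤G) = ≤⇒≤ᵖ G≤H , ≤⇒≤ᵖ H≤G

-- Disjunctive sum

infix 4 _∈ᴸ_ _∈ᴿ_

_∈ᴸ_ _∈ᴿ_ : PG → PG → Set
Y ∈ᴸ H = ∃ λ i → left H i ≡ Y
Y ∈ᴿ H = ∃ λ j → right H j ≡ Y

⧏-introˡ′ : ∀ {G H Y} → Y ∈ᴸ H → G ≤ Y → G ⧏ H
⧏-introˡ′ (i , refl) = ⧏-introˡ i

⧏-introʳ′ : ∀ {G H Y} → Y ∈ᴿ G → Y ≤ H → G ⧏ H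
⧏-introʳ′ (j , refl) = ⧏-introʳ j

concatF-↑ˡ : ∀ {A : Set} a c (f : Fin a → A) (g : Fin c → A) i → concatF a c f g (i ↑ˡ c) ≡ f i
concatF-↑ˡ a c f g i = cong [ f , g ]′ (splitAt-↑ˡ a i c)

concatF-↑ʳ : ∀ {A : Set} a c (f : Fin a → A) (g : Fin c → A) i → concatF a c f g (a ↑ʳ i) ≡ g i
concatF-↑ʳ a c f g i = cong [ f , g ]′ (splitAt-↑ʳ a c i)

concatF-∀ : ∀ {A : Set} {P : A → Set} a c {f : Fin a → A} {g : Fin c → A} →
            (∀ i → P (f i)) → (∀ i → P (g i)) → ∀ k → P (concatF a c f g k)
concatF-∀ a c Pf Pg k with splitAt a k
... | inj₁ i = Pf i
... | inj₂ i = Pg i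

concatF-map-≈ : ∀ {A : Set} (h : A → PG) a c {f : Fin a → A} {g : Fin c → A}
                {f′ : Fin a → PG} {g′ : Fin c → PG} →
                (∀ i → h (f i) ≈ f′ i) → (∀ i → h (g i) ≈ g′ i) →
                ∀ k → h (concatF a c f g k) ≈ concatF a c f′ g′ k
concatF-map-≈ h a c hf≈f′ hg≈g′ k with splitAt a k
... | inj₁ i = hf≈f′ i
... | inj₂ i = hg≈g′ i

≋concatF⇒↑ˡ : ∀ {a c} {S : Fin (a ℕ.+ c) → PG} {f : Fin a → PG} {g : Fin c → PG} →
              (∀ k → S k ≈ concatF a c f g k) → ∀ i → S (i ↑ˡ c) ≈ f i
≋concatF⇒↑ˡ {a} {c} {S} {f} {g} S≈ i = subst (S (i ↑ˡ c) ≈_) (concatF-↑ˡ a c f g i) (S≈ (i ↑ˡ c))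

≋concatF⇒↑ʳ : ∀ {a c} {S : Fin (a ℕ.+ c) → PG} {f : Fin a → PG} {g : Fin c → PG} →
              (∀ k → S k ≈ concatF a c f g k) → ∀ i → S (a ↑ʳ i) ≈ g i
≋concatF⇒↑ʳ {a} {c} {S} {f} {g} S≈ i = subst (S (a ↑ʳ i) ≈_) (concatF-↑ʳ a c f g i) (S≈ (a ↑ʳ i))

left-+ᵖˡ : ∀ X Y i → left X i +ᵖ Y ∈ᴸ X +ᵖ Y
left-+ᵖˡ (mk a _ _ _) (mk c _ _ _) i = i ↑ˡ c , concatF-↑ˡ a c _ _ i

left-+ᵖʳ : ∀ X Y i → X +ᵖ left Y i ∈ᴸ X +ᵖ Y
left-+ᵖʳ (mk a _ _ _) (mk c _ _ _) i = a ↑ʳ i , concatF-↑ʳ a c _ _ i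

right-+ᵖˡ : ∀ X Y j → right X j +ᵖ Y ∈ᴿ X +ᵖ Y
right-+ᵖˡ (mk _ _ b _) (mk _ _ d _) j = j ↑ˡ d , concatF-↑ˡ b d _ _ j

right-+ᵖʳ : ∀ X Y j → X +ᵖ right Y j ∈ᴿ X +ᵖ Y
right-+ᵖʳ (mk _ _ b _) (mk _ _ d _) j = b ↑ʳ j , concatF-↑ʳ b d _ _ j

left-+ᵖ-∀ : ∀ {P : PG → Set} X Y → (∀ i → P (left X i +ᵖ Y)) → (∀ i → P (X +ᵖ left Y i)) →
            ∀ k → P (left (X +ᵖ Y) k)
left-+ᵖ-∀ {P} (mk a _ _ _) (mk c _ _ _) = concatF-∀ {P = P} a c

right-+ᵖ-∀ : ∀ {P : PG → Set} X Y → (∀ j → P (right X j +ᵖ Y)) → (∀ j → P (X +ᵖ right Y j)) →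
             ∀ k → P (right (X +ᵖ Y) k)
right-+ᵖ-∀ {P} (mk _ _ b _) (mk _ _ d _) = concatF-∀ {P = P} b d

+ᵖ-∈ᴸʳ : ∀ X Y {Y′} → Y′ ∈ᴸ Y → X +ᵖ Y′ ∈ᴸ X +ᵖ Y
+ᵖ-∈ᴸʳ X Y (i , refl) = left-+ᵖʳ X Y i

+ᵖ-∈ᴿˡ : ∀ X Y {X′} → X′ ∈ᴿ X → X′ +ᵖ Y ∈ᴿ X +ᵖ Y
+ᵖ-∈ᴿˡ X Y (j , refl) = right-+ᵖˡ X Y j

+ᵖ-∈ᴿʳ : ∀ X Y {Y′} → Y′ ∈ᴿ Y → X +ᵖ Y′ ∈ᴿ X +ᵖ Y
+ᵖ-∈ᴿʳ X Y (j , refl) = right-+ᵖʳ X Y j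

mutual
  +ᵖ-monoˡ-≤ : ∀ {X Y} Z → X ≤ Y → X +ᵖ Z ≤ Y +ᵖ Z
  +ᵖ-monoˡ-≤ {X@(mk _ L _ _)} {Y@(mk _ _ _ R)} Z@(mk _ L′ _ R′) X≤Y =
    ≤-intro
      (left-+ᵖ-∀ {λ V → V ⧏ Y +ᵖ Z} X Z
        (λ i → +ᵖ-monoˡ-⧏ Z (≤⇒left⧏ X≤Y i))
        (λ i → ⧏-introˡ′ (left-+ᵖʳ Y Z i) (+ᵖ-monoˡ-≤ (L′ i) X≤Y)))
      (right-+ᵖ-∀ {λ V → X +ᵖ Z ⧏ V} Y Z
        (λ j → +ᵖ-monoˡ-⧏ Z (≤⇒⧏right X≤Y j))
        (λ j → ⧏-introʳ′ (right-+ᵖʳ X Z j) (+ᵖ-monoˡ-≤ (R′ j) X≤Y)))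

  +ᵖ-monoˡ-⧏ : ∀ {X Y} Z → X ⧏ Y → X +ᵖ Z ⧏ Y +ᵖ Z
  +ᵖ-monoˡ-⧏ {X} {Y} Z X⧏Y = +ᵖ-monoˡ-⧏-cases {X} {Y} Z (⧏-elim X⧏Y)

  +ᵖ-monoˡ-⧏-cases : ∀ {X Y} Z → (∃ λ i → X ≤ left Y i) ⊎ (∃ λ j → right X j ≤ Y) →
                     X +ᵖ Z ⧏ Y +ᵖ Z
  +ᵖ-monoˡ-⧏-cases {X} {Y@(mk _ L _ _)} Z@(mk _ _ _ _) (inj₁ (i , X≤Yᴸ)) =
    ⧏-introˡ′ (left-+ᵖˡ Y Z i) (+ᵖ-monoˡ-≤ {X} {L i} Z X≤Yᴸ)
  +ᵖ-monoˡ-⧏-cases {X@(mk _ _ _ R)} {Y} Z@(mk _ _ _ _) (inj₂ (j , Xᴿ≤Y)) =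
    ⧏-introʳ′ (right-+ᵖˡ X Z j) (+ᵖ-monoˡ-≤ {R j} {Y} Z Xᴿ≤Y)

+ᵖ-comm-≤ : ∀ X Y → X +ᵖ Y ≤ Y +ᵖ X
+ᵖ-comm-≤ X@(mk _ L _ R) Y@(mk _ L′ _ R′) =
  ≤-intro
    (left-+ᵖ-∀ {λ V → V ⧏ Y +ᵖ X} X Y
      (λ i → ⧏-introˡ′ (left-+ᵖʳ Y X i) (+ᵖ-comm-≤ (L i) Y))
      (λ i → ⧏-introˡ′ (left-+ᵖˡ Y X i) (+ᵖ-comm-≤ X (L′ i))))
    (right-+ᵖ-∀ {λ V → X +ᵖ Y ⧏ V} Y X
      (λ j → ⧏-introʳ′ (right-+ᵖʳ X Y j) (+ᵖ-comm-≤ X (R′ j)))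
      (λ j → ⧏-introʳ′ (right-+ᵖˡ X Y j) (+ᵖ-comm-≤ (R j) Y)))

+ᵖ-comm : ∀ X Y → X +ᵖ Y ≈ Y +ᵖ X
+ᵖ-comm X Y = +ᵖ-comm-≤ X Y , +ᵖ-comm-≤ Y X

+ᵖ-monoʳ-≤ : ∀ Z {X Y} → X ≤ Y → Z +ᵖ X ≤ Z +ᵖ Y
+ᵖ-monoʳ-≤ Z {X} {Y} X≤Y =
  ≤-trans (+ᵖ-comm-≤ Z X) (≤-trans (+ᵖ-monoˡ-≤ Z X≤Y) (+ᵖ-comm-≤ Y Z))

+ᵖ-monoʳ-⧏ : ∀ Z {X Y} → X ⧏ Y → Z +ᵖ X ⧏ Z +ᵖ Y
+ᵖ-monoʳ-⧏ Z {X} {Y} X⧏Y =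
  ≤-⧏-trans (+ᵖ-comm-≤ Z X) (⧏-≤-trans (+ᵖ-monoˡ-⧏ Z X⧏Y) (+ᵖ-comm-≤ Y Z))

sum-left⧏ : ∀ {a c} {AL : Fin a → PG} {BL : Fin c → PG} {A B} →
            (∀ i → AL i ⧏ A) → (∀ i → BL i ⧏ B) →
            ∀ k → concatF a c (λ i → AL i +ᵖ B) (λ i → A +ᵖ BL i) k ⧏ A +ᵖ B
sum-left⧏ {a} {c} {A = A} {B} AL⧏A BL⧏B =
  concatF-∀ {P = _⧏ A +ᵖ B} a c (λ i → +ᵖ-monoˡ-⧏ B (AL⧏A i)) (λ i → +ᵖ-monoʳ-⧏ A (BL⧏B i))

⧏sum-right : ∀ {b d} {AR : Fin b → PG} {BR : Fin d → PG} {A B} →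
             (∀ j → A ⧏ AR j) → (∀ j → B ⧏ BR j) →
             ∀ k → A +ᵖ B ⧏ concatF b d (λ j → AR j +ᵖ B) (λ j → A +ᵖ BR j) k
⧏sum-right {b} {d} {A = A} {B} A⧏AR B⧏BR =
  concatF-∀ {P = A +ᵖ B ⧏_} b d (λ j → +ᵖ-monoˡ-⧏ B (A⧏AR j)) (λ j → +ᵖ-monoʳ-⧏ A (B⧏BR j))

+ᵖ-mono-≤ : ∀ {X X′ Y Y′} → X ≤ X′ → Y ≤ Y′ → X +ᵖ Y ≤ X′ +ᵖ Y′
+ᵖ-mono-≤ {X′ = X′} {Y} X≤X′ Y≤Y′ = ≤-trans (+ᵖ-monoˡ-≤ Y X≤X′) (+ᵖ-monoʳ-≤ X′ Y≤Y′)

+ᵖ-cong : ∀ {X X′ Y Y′} → X ≈ X′ → Y ≈ Y′ → X +ᵖ Y ≈ X′ +ᵖ Y′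
+ᵖ-cong (X≤X′ , X′≤X) (Y≤Y′ , Y′≤Y) = +ᵖ-mono-≤ X≤X′ Y≤Y′ , +ᵖ-mono-≤ X′≤X Y′≤Y

+ᵖ-assoc-≤ : ∀ X Y Z → (X +ᵖ Y) +ᵖ Z ≤ X +ᵖ (Y +ᵖ Z)
+ᵖ-assoc-≤ X@(mk _ L _ R) Y@(mk _ L′ _ R′) Z@(mk _ L″ _ R″) =
  ≤-intro
    (left-+ᵖ-∀ {λ V → V ⧏ X +ᵖ (Y +ᵖ Z)} (X +ᵖ Y) Z
      (left-+ᵖ-∀ {λ V → V +ᵖ Z ⧏ X +ᵖ (Y +ᵖ Z)} X Y
        (λ i → ⧏-introˡ′ (left-+ᵖˡ X (Y +ᵖ Z) i) (+ᵖ-assoc-≤ (L i) Y Z))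
        (λ i → ⧏-introˡ′ (+ᵖ-∈ᴸʳ X (Y +ᵖ Z) (left-+ᵖˡ Y Z i)) (+ᵖ-assoc-≤ X (L′ i) Z)))
      (λ i → ⧏-introˡ′ (+ᵖ-∈ᴸʳ X (Y +ᵖ Z) (left-+ᵖʳ Y Z i)) (+ᵖ-assoc-≤ X Y (L″ i))))
    (right-+ᵖ-∀ {λ V → (X +ᵖ Y) +ᵖ Z ⧏ V} X (Y +ᵖ Z)
      (λ j → ⧏-introʳ′ (+ᵖ-∈ᴿˡ (X +ᵖ Y) Z (right-+ᵖˡ X Y j)) (+ᵖ-assoc-≤ (R j) Y Z))
      (right-+ᵖ-∀ {λ V → (X +ᵖ Y) +ᵖ Z ⧏ X +ᵖ V} Y Z
        (λ j → ⧏-introʳ′ (+ᵖ-∈ᴿˡ (X +ᵖ Y) Z (right-+ᵖʳ X Y j)) (+ᵖ-assoc-≤ X (R′ j) Z))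
        (λ j → ⧏-introʳ′ (right-+ᵖʳ (X +ᵖ Y) Z j) (+ᵖ-assoc-≤ X Y (R″ j)))))

+ᵖ-assoc : ∀ X Y Z → (X +ᵖ Y) +ᵖ Z ≈ X +ᵖ (Y +ᵖ Z)
+ᵖ-assoc X Y Z = +ᵖ-assoc-≤ X Y Z , backwards
  where
  backwards : X +ᵖ (Y +ᵖ Z) ≤ (X +ᵖ Y) +ᵖ Z
  backwards = begin
    X +ᵖ (Y +ᵖ Z)  ≤⟨ +ᵖ-comm-≤ X (Y +ᵖ Z) ⟩
    (Y +ᵖ Z) +ᵖ X  ≤⟨ +ᵖ-assoc-≤ Y Z X ⟩
    Y +ᵖ (Z +ᵖ X)  ≤⟨ +ᵖ-comm-≤ Y (Z +ᵖ X) ⟩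
    (Z +ᵖ X) +ᵖ Y  ≤⟨ +ᵖ-assoc-≤ Z X Y ⟩
    Z +ᵖ (X +ᵖ Y)  ≤⟨ +ᵖ-comm-≤ Z (X +ᵖ Y) ⟩
    (X +ᵖ Y) +ᵖ Z  ∎
    where open Relation.Binary.Reasoning.PartialOrder ≤-poset

+ᵖ-identityʳ : ∀ X → X +ᵖ zeroᵖ ≈ X
+ᵖ-identityʳ X = shrink X , grow X
  where
  shrink : ∀ X → X +ᵖ zeroᵖ ≤ X
  shrink X@(mk _ L _ R) =
    ≤-intro (left-+ᵖ-∀ {λ V → V ⧏ X} X zeroᵖ (λ i → ≤-⧏-trans (shrink (L i)) (left⧏ X i)) (λ ()))
            (λ j → ⧏-introʳ′ (right-+ᵖˡ X zeroᵖ j) (shrink (R j)))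
  grow : ∀ X → X ≤ X +ᵖ zeroᵖ
  grow X@(mk _ L _ R) =
    ≤-intro (λ i → ⧏-introˡ′ (left-+ᵖˡ X zeroᵖ i) (grow (L i)))
            (right-+ᵖ-∀ {λ V → X ⧏ V} X zeroᵖ (λ j → ⧏-≤-trans (⧏right X j) (grow (R j))) (λ ()))

+ᵖ-identityˡ : ∀ X → zeroᵖ +ᵖ X ≈ X
+ᵖ-identityˡ X = ≈-trans (+ᵖ-comm zeroᵖ X) (+ᵖ-identityʳ X)

+ᵖ-commutativeMonoid : CommutativeMonoid _ _
+ᵖ-commutativeMonoid = record
  { _≈_ = _≈_
  ; _∙_ = _+ᵖ_
  ; ε   = zeroᵖ
  ; isCommutativeMonoid = record
    { isMonoid = record
      { isSemigroup = record
        { isMagma = record { isEquivalence = ≈-isEquivalence ; ∙-cong = +ᵖ-cong }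
        ; assoc   = +ᵖ-assoc
        }
      ; identity = +ᵖ-identityˡ , +ᵖ-identityʳ
      }
    ; comm = +ᵖ-comm
    }
  }

open import Algebra.Properties.CommutativeSemigroup (CommutativeMonoid.commutativeSemigroup +ᵖ-commutativeMonoid)
  using (x∙yz≈xz∙y; x∙yz≈z∙xy; xy∙z≈y∙xz)

-- Integers as games

m+[n-m]≡n : ∀ m n → m + (n - m) ≡ n
m+[n-m]≡n = solve-∀

ℤ-ind-towards-0 : (P : ℤ → Set) →
                  (∀ n → (+ 0 ℤ.< n → P (pred n)) → (n ℤ.< + 0 → P (sucℤ n)) → P n) →
                  ∀ n → P n
ℤ-ind-towards-0 P step (+ zero)     = step (+ zero) (λ { (+<+ ()) }) (λ { (+<+ ()) })
ℤ-ind-towards-0 P step (+ suc n)    =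
  step (+ suc n) (λ _ → ℤ-ind-towards-0 P step (+ n)) (λ { (+<+ ()) })
ℤ-ind-towards-0 P step -[1+ zero ]  = step -[1+ zero ] (λ ()) (λ _ → ℤ-ind-towards-0 P step (+ zero))
ℤ-ind-towards-0 P step -[1+ suc n ] = step -[1+ suc n ] (λ ()) (λ _ → ℤ-ind-towards-0 P step -[1+ n ])

ℤ-crossing : ∀ {ℓ} (P : Pred ℤ ℓ) → Decidable P → ∀ {m n} → m ℤ.≤ n → P m → ¬ P n →
             ∃ λ k → P k × ¬ P (sucℤ k)
ℤ-crossing P P? {m} {n} m≤n Pm ¬Pn = walk m ℤ.∣ n - m ∣ Pm (subst (¬_ ∘ P) (sym m+d≡n) ¬Pn)
  where
  m+d≡n : m + + ℤ.∣ n - m ∣ ≡ n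
  m+d≡n = trans (cong (λ d → m + d) (ℤ.0≤i⇒+∣i∣≡i (ℤ.i≤j⇒0≤j-i m≤n))) (m+[n-m]≡n m n)
  [1+m]+t≡m+[1+t] : ∀ m t → (+ 1 + m) + t ≡ m + (+ 1 + t)
  [1+m]+t≡m+[1+t] = solve-∀
  walk : ∀ m t → P m → ¬ P (m + + t) → ∃ λ k → P k × ¬ P (sucℤ k)
  walk m zero    Pm ¬Pm+0 = ⊥-elim (¬Pm+0 (subst P (sym (ℤ.+-identityʳ m)) Pm))
  walk m (suc t) Pm ¬Pm+t with P? (sucℤ m)
  ... | no  ¬P1+m = m , Pm , ¬P1+m
  ... | yes P1+m  = walk (sucℤ m) t P1+m (subst (¬_ ∘ P) (sym ([1+m]+t≡m+[1+t] m (+ t))) ¬Pm+t)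

left-intᵖ : ∀ k i → left (intᵖ k) i ≡ intᵖ (pred k)
left-intᵖ (+ suc n) zero = refl
left-intᵖ -[1+ zero ]  ()
left-intᵖ -[1+ suc n ] ()

right-intᵖ : ∀ k j → right (intᵖ k) j ≡ intᵖ (sucℤ k)
right-intᵖ -[1+ zero ]  zero = refl
right-intᵖ -[1+ suc n ] zero = refl
right-intᵖ (+ zero)  ()
right-intᵖ (+ suc n) ()

left-intᵖ⇒pos : ∀ k → Fin (#left (intᵖ k)) → + 0 ℤ.< k
left-intᵖ⇒pos (+ suc n) zero = +<+ (s≤s z≤n)
left-intᵖ⇒pos -[1+ zero ]  ()
left-intᵖ⇒pos -[1+ suc n ] ()

right-intᵖ⇒neg : ∀ k → Fin (#right (intᵖ k)) → k ℤ.< + 0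
right-intᵖ⇒neg -[1+ zero ]  zero = -<+
right-intᵖ⇒neg -[1+ suc n ] zero = -<+
right-intᵖ⇒neg (+ zero)  ()
right-intᵖ⇒neg (+ suc n) ()

pred-∈ᴸ-intᵖ : ∀ {k} → + 0 ℤ.< k → intᵖ (pred k) ∈ᴸ intᵖ k
pred-∈ᴸ-intᵖ {+ suc n} _ = zero , refl
pred-∈ᴸ-intᵖ {+ zero} (+<+ ())

suc-∈ᴿ-intᵖ : ∀ {k} → k ℤ.< + 0 → intᵖ (sucℤ k) ∈ᴿ intᵖ k
suc-∈ᴿ-intᵖ { -[1+ zero ]}  _ = zero , refl
suc-∈ᴿ-intᵖ { -[1+ suc n ]} _ = zero , refl
suc-∈ᴿ-intᵖ {+ n} (+<+ ())

intᵖ-⧏-suc : ∀ k → intᵖ k ⧏ intᵖ (sucℤ k)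
intᵖ-⧏-suc (+ n)          = ⧏-introˡ zero ≤-refl
intᵖ-⧏-suc -[1+ zero ]    = ⧏-introʳ zero ≤-refl
intᵖ-⧏-suc -[1+ suc n ]   = ⧏-introʳ zero ≤-refl

intᵖ-neg≤0 : ∀ m → intᵖ -[1+ m ] ≤ intᵖ (+ 0)
intᵖ-neg≤0 zero    = ≤-intro (λ ()) (λ ())
intᵖ-neg≤0 (suc m) = ≤-intro (λ ()) (λ ())

intᵖ-mono-≤ : ∀ {m n} → m ℤ.≤ n → intᵖ m ≤ intᵖ n
intᵖ-mono-≤ (+≤+ m≤n)     = nonneg m≤n
  where
  nonneg : ∀ {m n} → m ℕ.≤ n → intᵖ (+ m) ≤ intᵖ (+ n)
  nonneg {zero}  {zero}  _         = ≤-refl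
  nonneg {zero}  {suc n} _         = ≤-intro (λ ()) (λ ())
  nonneg {suc m} {suc n} (s≤s m≤n) = ≤-intro (λ { zero → ⧏-introˡ zero (nonneg m≤n) }) (λ ())
intᵖ-mono-≤ (-≤- n≤m)     = neg n≤m
  where
  neg : ∀ {m n} → n ℕ.≤ m → intᵖ -[1+ m ] ≤ intᵖ -[1+ n ]
  neg {zero}  {zero}  _         = ≤-refl
  neg {suc m} {zero}  _         = ≤-intro (λ ()) (λ { zero → ⧏-introʳ zero (intᵖ-neg≤0 m) })
  neg {suc m} {suc n} (s≤s n≤m) = ≤-intro (λ ()) (λ { zero → ⧏-introʳ zero (neg n≤m) })
intᵖ-mono-≤ (-≤+ {m})     = ≤-trans (intᵖ-neg≤0 m) (intᵖ-mono-≤ (+≤+ z≤n))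

intᵖ-mono-< : ∀ {m n} → m ℤ.< n → intᵖ m ⧏ intᵖ n
intᵖ-mono-< {m} m<n = ⧏-≤-trans (intᵖ-⧏-suc m) (intᵖ-mono-≤ (ℤ.i<j⇒suc[i]≤j m<n))

intᵖ-cancel-⧏ : ∀ {m n} → intᵖ m ⧏ intᵖ n → m ℤ.< n
intᵖ-cancel-⧏ {m} {n} m⧏n with m ℤ.<? n
... | yes m<n = m<n
... | no  m≮n = ⊥-elim (⧏⇒≱ m⧏n (intᵖ-mono-≤ (ℤ.≮⇒≥ m≮n)))

≈intᵖ-byOptions : ∀ X {l k r} → sucℤ l ≡ k → sucℤ k ≡ r →
  (∀ i → left X i ≤ intᵖ l) → (∀ j → intᵖ r ≤ right X j) →
  (+ 0 ℤ.< k → ∃ λ Y → Y ∈ᴸ X × intᵖ l ≤ Y) →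
  (k ℤ.< + 0 → ∃ λ Y → Y ∈ᴿ X × Y ≤ intᵖ r) →
  X ≈ intᵖ k
≈intᵖ-byOptions X {l} refl refl Xᴸ≤l r≤Xᴿ l≤someXᴸ someXᴿ≤r =
  ≤-intro (λ i → ≤-⧏-trans (Xᴸ≤l i) (intᵖ-⧏-suc l))
          (λ j → let _ , Y∈ᴿX , Y≤r = someXᴿ≤r (right-intᵖ⇒neg k j) in
                 subst (X ⧏_) (sym (right-intᵖ k j)) (⧏-introʳ′ Y∈ᴿX Y≤r)) ,
  ≤-intro (λ i → let _ , Y∈ᴸX , l≤Y = l≤someXᴸ (left-intᵖ⇒pos k i) in
                 subst (_⧏ X) (sym (trans (left-intᵖ k i) (cong intᵖ (ℤ.pred-suc l))))
                       (⧏-introˡ′ Y∈ᴸX l≤Y))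
          (λ j → ⧏-≤-trans (intᵖ-⧏-suc k) (r≤Xᴿ j))
  where
  k : ℤ
  k = sucℤ l

oneᵖ : PG
oneᵖ = intᵖ (+ 1)

intᵖ-1+ : ∀ n → oneᵖ +ᵖ intᵖ n ≈ intᵖ (sucℤ n)
intᵖ-1+ = ℤ-ind-towards-0 (λ n → oneᵖ +ᵖ intᵖ n ≈ intᵖ (sucℤ n)) step
  where
  open Relation.Binary.Reasoning.PartialOrder ≤-poset
  step : ∀ n → (+ 0 ℤ.< n → oneᵖ +ᵖ intᵖ (pred n) ≈ intᵖ (sucℤ (pred n))) →
         (n ℤ.< + 0 → oneᵖ +ᵖ intᵖ (sucℤ n) ≈ intᵖ (sucℤ (sucℤ n))) →
         oneᵖ +ᵖ intᵖ n ≈ intᵖ (sucℤ n)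
  step n IHpred IHsuc = ≈intᵖ-byOptions (oneᵖ +ᵖ intᵖ n) refl refl
    (left-+ᵖ-∀ {_≤ intᵖ n} oneᵖ (intᵖ n) (λ { zero → proj₁ (+ᵖ-identityˡ (intᵖ n)) }) 1+nᴸ≤n)
    (right-+ᵖ-∀ {intᵖ (sucℤ (sucℤ n)) ≤_} oneᵖ (intᵖ n) (λ ()) n+2≤1+nᴿ)
    (λ _ → _ , left-+ᵖˡ oneᵖ (intᵖ n) zero , proj₂ (+ᵖ-identityˡ (intᵖ n)))
    (λ 1+n<0 → let n<0 = ℤ.≤-<-trans (ℤ.i≤suc[i] n) 1+n<0 in
               _ , +ᵖ-∈ᴿʳ oneᵖ (intᵖ n) (suc-∈ᴿ-intᵖ n<0) , proj₁ (IHsuc n<0))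
    where
    1+nᴸ≤n : ∀ i → oneᵖ +ᵖ left (intᵖ n) i ≤ intᵖ n
    1+nᴸ≤n i = begin
      oneᵖ +ᵖ left (intᵖ n) i  ≡⟨ cong (oneᵖ +ᵖ_) (left-intᵖ n i) ⟩
      oneᵖ +ᵖ intᵖ (pred n)    ≤⟨ proj₁ (IHpred (left-intᵖ⇒pos n i)) ⟩
      intᵖ (sucℤ (pred n))     ≡⟨ cong intᵖ (ℤ.suc-pred n) ⟩
      intᵖ n                   ∎
    n+2≤1+nᴿ : ∀ j → intᵖ (sucℤ (sucℤ n)) ≤ oneᵖ +ᵖ right (intᵖ n) j
    n+2≤1+nᴿ j = begin
      intᵖ (sucℤ (sucℤ n))      ≤⟨ proj₂ (IHsuc (right-intᵖ⇒neg n j)) ⟩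
      oneᵖ +ᵖ intᵖ (sucℤ n)     ≡⟨ cong (oneᵖ +ᵖ_) (right-intᵖ n j) ⟨
      oneᵖ +ᵖ right (intᵖ n) j  ∎

intᵖ-[-1]+ : ∀ n → intᵖ -[1+ 0 ] +ᵖ intᵖ n ≈ intᵖ (pred n)
intᵖ-[-1]+ = ℤ-ind-towards-0 (λ n → -one +ᵖ intᵖ n ≈ intᵖ (pred n)) step
  where
  -one : PG
  -one = intᵖ -[1+ 0 ]
  open Relation.Binary.Reasoning.PartialOrder ≤-poset
  step : ∀ n → (+ 0 ℤ.< n → -one +ᵖ intᵖ (pred n) ≈ intᵖ (pred (pred n))) →
         (n ℤ.< + 0 → -one +ᵖ intᵖ (sucℤ n) ≈ intᵖ (pred (sucℤ n))) →
         -one +ᵖ intᵖ n ≈ intᵖ (pred n)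
  step n IHpred IHsuc = ≈intᵖ-byOptions (-one +ᵖ intᵖ n) (ℤ.suc-pred (pred n)) (ℤ.suc-pred n)
    (left-+ᵖ-∀ {_≤ intᵖ (pred (pred n))} -one (intᵖ n) (λ ()) -1+nᴸ≤n-2)
    (right-+ᵖ-∀ {intᵖ n ≤_} -one (intᵖ n) (λ { zero → proj₂ (+ᵖ-identityˡ (intᵖ n)) }) n≤-1+nᴿ)
    (λ 0<n-1 → let 0<n = ℤ.i≤pred[j]⇒i<j (ℤ.<⇒≤ 0<n-1) in
               _ , +ᵖ-∈ᴸʳ -one (intᵖ n) (pred-∈ᴸ-intᵖ 0<n) , proj₂ (IHpred 0<n))
    (λ _ → _ , right-+ᵖˡ -one (intᵖ n) zero , proj₁ (+ᵖ-identityˡ (intᵖ n)))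
    where
    -1+nᴸ≤n-2 : ∀ i → -one +ᵖ left (intᵖ n) i ≤ intᵖ (pred (pred n))
    -1+nᴸ≤n-2 i = begin
      -one +ᵖ left (intᵖ n) i  ≡⟨ cong (-one +ᵖ_) (left-intᵖ n i) ⟩
      -one +ᵖ intᵖ (pred n)    ≤⟨ proj₁ (IHpred (left-intᵖ⇒pos n i)) ⟩
      intᵖ (pred (pred n))     ∎
    n≤-1+nᴿ : ∀ j → intᵖ n ≤ -one +ᵖ right (intᵖ n) j
    n≤-1+nᴿ j = begin
      intᵖ n                    ≡⟨ cong intᵖ (ℤ.pred-suc n) ⟨
      intᵖ (pred (sucℤ n))      ≤⟨ proj₂ (IHsuc (right-intᵖ⇒neg n j)) ⟩
      -one +ᵖ intᵖ (sucℤ n)     ≡⟨ cong (-one +ᵖ_) (right-intᵖ n j) ⟨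
      -one +ᵖ right (intᵖ n) j  ∎

intᵖ-homo-+ : ∀ m n → intᵖ m +ᵖ intᵖ n ≈ intᵖ (m + n)
intᵖ-homo-+ (+ zero) n rewrite ℤ.+-identityˡ n = +ᵖ-identityˡ (intᵖ n)
intᵖ-homo-+ (+ suc m) n = begin-equality
  intᵖ (+ suc m) +ᵖ intᵖ n        ≈⟨ +ᵖ-cong (intᵖ-1+ (+ m)) ≈-refl ⟨
  (oneᵖ +ᵖ intᵖ (+ m)) +ᵖ intᵖ n  ≈⟨ +ᵖ-assoc _ _ _ ⟩
  oneᵖ +ᵖ (intᵖ (+ m) +ᵖ intᵖ n)  ≈⟨ +ᵖ-cong ≈-refl (intᵖ-homo-+ (+ m) n) ⟩
  oneᵖ +ᵖ intᵖ (+ m + n)          ≈⟨ intᵖ-1+ (+ m + n) ⟩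
  intᵖ (+ 1 + (+ m + n))          ≡⟨ cong intᵖ (ℤ.+-assoc (+ 1) (+ m) n) ⟨
  intᵖ (+ suc m + n)              ∎
  where open Relation.Binary.Reasoning.PartialOrder ≤-poset
intᵖ-homo-+ -[1+ zero ] n = intᵖ-[-1]+ n
intᵖ-homo-+ -[1+ suc m ] n = begin-equality
  intᵖ -[1+ suc m ] +ᵖ intᵖ n                 ≈⟨ +ᵖ-cong (intᵖ-[-1]+ -[1+ m ]) ≈-refl ⟨
  (intᵖ -[1+ 0 ] +ᵖ intᵖ -[1+ m ]) +ᵖ intᵖ n  ≈⟨ +ᵖ-assoc _ _ _ ⟩
  intᵖ -[1+ 0 ] +ᵖ (intᵖ -[1+ m ] +ᵖ intᵖ n)  ≈⟨ +ᵖ-cong ≈-refl (intᵖ-homo-+ -[1+ m ] n) ⟩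
  intᵖ -[1+ 0 ] +ᵖ intᵖ (-[1+ m ] + n)        ≈⟨ intᵖ-[-1]+ (-[1+ m ] + n) ⟩
  intᵖ (-[1+ 0 ] + (-[1+ m ] + n))            ≡⟨ cong intᵖ (ℤ.+-assoc -[1+ 0 ] -[1+ m ] n) ⟨
  intᵖ (-[1+ suc m ] + n)                     ∎
  where open Relation.Binary.Reasoning.PartialOrder ≤-poset

intᵖ-+1 : ∀ k → intᵖ k +ᵖ oneᵖ ≈ intᵖ (sucℤ k)
intᵖ-+1 k = ≈-trans (+ᵖ-comm (intᵖ k) oneᵖ) (intᵖ-1+ k)

intᵖ-split : ∀ m s → intᵖ s ≈ intᵖ m +ᵖ intᵖ (s - m)
intᵖ-split m s = ≈-sym (≈-trans (intᵖ-homo-+ m (s - m)) (≈-reflexive (cong intᵖ (m+[n-m]≡n m s))))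

intᵖ-+ᵖ-inverse : ∀ m X → intᵖ (- m) +ᵖ (intᵖ m +ᵖ X) ≈ X
intᵖ-+ᵖ-inverse m X = begin-equality
  intᵖ (- m) +ᵖ (intᵖ m +ᵖ X)  ≈⟨ +ᵖ-assoc _ _ _ ⟨
  (intᵖ (- m) +ᵖ intᵖ m) +ᵖ X  ≈⟨ +ᵖ-cong (intᵖ-homo-+ (- m) m) ≈-refl ⟩
  intᵖ (- m + m) +ᵖ X          ≡⟨ cong (λ k → intᵖ k +ᵖ X) (ℤ.+-inverseˡ m) ⟩
  zeroᵖ +ᵖ X                   ≈⟨ +ᵖ-identityˡ X ⟩
  X                            ∎
  where open Relation.Binary.Reasoning.PartialOrder ≤-poset

intᵖ-+ᵖ-cancelˡ-≤ : ∀ m {X Y} → intᵖ m +ᵖ X ≤ intᵖ m +ᵖ Y → X ≤ Y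
intᵖ-+ᵖ-cancelˡ-≤ m {X} {Y} m+X≤m+Y = begin
  X                            ≈⟨ intᵖ-+ᵖ-inverse m X ⟨
  intᵖ (- m) +ᵖ (intᵖ m +ᵖ X)  ≤⟨ +ᵖ-monoʳ-≤ (intᵖ (- m)) m+X≤m+Y ⟩
  intᵖ (- m) +ᵖ (intᵖ m +ᵖ Y)  ≈⟨ intᵖ-+ᵖ-inverse m Y ⟩
  Y                            ∎
  where open Relation.Binary.Reasoning.PartialOrder ≤-poset

intᵖ-+ᵖ-cancelˡ-⧏ : ∀ m {X Y} → intᵖ m +ᵖ X ⧏ intᵖ m +ᵖ Y → X ⧏ Y
intᵖ-+ᵖ-cancelˡ-⧏ m {X} {Y} m+X⧏m+Y =
  ⧏-resp-≈ (intᵖ-+ᵖ-inverse m X) (intᵖ-+ᵖ-inverse m Y) (+ᵖ-monoʳ-⧏ (intᵖ (- m)) m+X⧏m+Y)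

maxF-upper : ∀ n (f : Fin n → ℕ) i → f i ℕ.≤ maxF n f
maxF-upper (suc n) f zero    = ℕ.m≤m⊔n (f zero) _
maxF-upper (suc n) f (suc i) = ℕ.m≤n⇒m≤o⊔n (f zero) (maxF-upper n (f ∘ suc) i)

≤intᵖ-rank : ∀ X → X ≤ intᵖ (+ rank X)
≤intᵖ-rank (mk a L b R) =
  ≤-intro (λ i → ⧏-introˡ zero (≤-trans (≤intᵖ-rank (L i)) (intᵖ-mono-≤ (+≤+ (rankL≤ i)))))
          (λ ())
  where
  rankL≤ : ∀ i → rank (L i) ℕ.≤ maxF a (rank ∘ L) ⊔ maxF b (rank ∘ R)
  rankL≤ i = ℕ.m≤n⇒m≤n⊔o _ (maxF-upper a (rank ∘ L) i)

intᵖ-neg-rank≤ : ∀ X → intᵖ (- + rank X) ≤ X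
intᵖ-neg-rank≤ (mk a L b R) = -[1+r]≤ (λ j → ℕ.m≤n⇒m≤o⊔n _ (maxF-upper b (rank ∘ R) j))
  where
  -r≤Rj : ∀ {r} j → rank (R j) ℕ.≤ r → intᵖ (- + r) ≤ R j
  -r≤Rj j rankRj≤r = ≤-trans (intᵖ-mono-≤ (ℤ.neg-mono-≤ (+≤+ rankRj≤r))) (intᵖ-neg-rank≤ (R j))
  -[1+r]≤ : ∀ {r} → (∀ j → rank (R j) ℕ.≤ r) → intᵖ -[1+ r ] ≤ mk a L b R
  -[1+r]≤ {zero}  rankR≤r = ≤-intro (λ ()) (λ j → ⧏-introʳ zero (-r≤Rj j (rankR≤r j)))
  -[1+r]≤ {suc r} rankR≤r = ≤-intro (λ ()) (λ j → ⧏-introʳ zero (-r≤Rj j (rankR≤r j)))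

-- The braces { L | R }±

Between : ∀ {a b} → (Fin a → PG) → (Fin b → PG) → ℤ → Set
Between L R n = (∀ i → L i ⧏ intᵖ n) × (∀ j → intᵖ n ⧏ R j)

NoIntegerBetween : ∀ {a b} → (Fin a → PG) → (Fin b → PG) → Set
NoIntegerBetween L R = ∀ n → ¬ Between L R n

between⁺ : ∀ {a b} (L : Fin a → PG) (R : Fin b → PG) {n} → Between L R n → T (between a L b R n)
between⁺ {a} {b} L R (L⧏n , n⧏R) =
  from T-∧ (allF⁺ a (⧏⇒⧏ᵖ ∘ L⧏n) , allF⁺ b (⧏⇒⧏ᵖ ∘ n⧏R))

between⁻ : ∀ {a b} (L : Fin a → PG) (R : Fin b → PG) {n} → T (between a L b R n) → Between L R n
between⁻ {a} {b} L R p =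
  let Lp , Rp = to T-∧ p in (⧏ᵖ⇒⧏ ∘ allF⁻ a Lp) , (⧏ᵖ⇒⧏ ∘ allF⁻ b Rp)

Between⇒bounded : ∀ {a b} (L : Fin (suc a) → PG) (R : Fin (suc b) → PG) {n} → Between L R n →
                  - + optBound (suc a) L (suc b) R ℤ.≤ n × n ℤ.≤ + optBound (suc a) L (suc b) R
Between⇒bounded {a} {b} L R {n} (L⧏n , n⧏R) =
  ℤ.≤-trans (ℤ.neg-mono-≤ (+≤+ rankL₀≤B)) (ℤ.<⇒≤ -rankL₀<n) ,
  ℤ.≤-trans (ℤ.<⇒≤ n<rankR₀) (+≤+ rankR₀≤B)
  where
  rankL₀≤B : rank (L zero) ℕ.≤ optBound (suc a) L (suc b) R
  rankL₀≤B = ℕ.m≤n⇒m≤n⊔o _ (maxF-upper (suc a) (rank ∘ L) zero)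
  rankR₀≤B : rank (R zero) ℕ.≤ optBound (suc a) L (suc b) R
  rankR₀≤B = ℕ.m≤n⇒m≤o⊔n (maxF (suc a) (rank ∘ L)) (maxF-upper (suc b) (rank ∘ R) zero)
  -rankL₀<n : - + rank (L zero) ℤ.< n
  -rankL₀<n = intᵖ-cancel-⧏ (≤-⧏-trans (intᵖ-neg-rank≤ (L zero)) (L⧏n zero))
  n<rankR₀ : n ℤ.< + rank (R zero)
  n<rankR₀ = intᵖ-cancel-⧏ (⧏-≤-trans (n⧏R zero) (≤intᵖ-rank (R zero)))

Between-resp-≋ : ∀ {a b} {SL L : Fin a → PG} {SR R : Fin b → PG} →
                 (∀ i → SL i ≈ L i) → (∀ j → SR j ≈ R j) → ∀ {n} → Between SL SR n → Between L R n
Between-resp-≋ SL≈L SR≈R (SL⧏n , n⧏SR) =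
  (λ i → ≤-⧏-trans (proj₂ (SL≈L i)) (SL⧏n i)) , (λ j → ⧏-≤-trans (n⧏SR j) (proj₁ (SR≈R j)))

Between-reindex : ∀ {a b a′ b′} {L : Fin a → PG} {R : Fin b → PG}
                  (f : Fin a′ → Fin a) (g : Fin b′ → Fin b) →
                  ∀ {n} → Between L R n → Between (L ∘ f) (R ∘ g) n
Between-reindex f g (L⧏n , n⧏R) = L⧏n ∘ f , n⧏R ∘ g

Between-≈intᵖ : ∀ {a b} {L : Fin a → PG} {R : Fin b → PG} {X n} →
                (∀ i → L i ⧏ X) → (∀ j → X ⧏ R j) → X ≈ intᵖ n → Between L R n
Between-≈intᵖ L⧏X X⧏R (X≤n , n≤X) = (λ i → ⧏-≤-trans (L⧏X i) X≤n) , (λ j → ≤-⧏-trans n≤X (X⧏R j))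

Between-unshift : ∀ m {a b} {SL L : Fin a → PG} {SR R : Fin b → PG} →
  (∀ i → SL i ≈ intᵖ m +ᵖ L i) → (∀ j → SR j ≈ intᵖ m +ᵖ R j) →
  ∀ {s} → Between SL SR s → Between L R (s - m)
Between-unshift m SL≈ SR≈ {s} (SL⧏s , s⧏SR) =
  (λ i → intᵖ-+ᵖ-cancelˡ-⧏ m (⧏-resp-≈ (SL≈ i) (intᵖ-split m s) (SL⧏s i))) ,
  (λ j → intᵖ-+ᵖ-cancelˡ-⧏ m (⧏-resp-≈ (intᵖ-split m s) (SR≈ j) (s⧏SR j)))

-- Brace _⊑_ L R G: G is the value of { L | R }±, the collapse choosing the
-- ⊑-greatest integer between the options (⊑ is ≤ for ψ⁺ and ≥ for ψ⁻).
data Brace (_⊑_ : ℤ → ℤ → Set) {a b} (L : Fin a → PG) (R : Fin b → PG) : PG → Set where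
  plain    : NoIntegerBetween L R → Brace _⊑_ L R (mk a L b R)
  collapse : ∀ n → Between L R n → (∀ m → Between L R m → m ⊑ n) → Brace _⊑_ L R (intᵖ n)

Brace⇒left⧏ : ∀ {_⊑_ a b} {L : Fin a → PG} {R : Fin b → PG} {G} → Brace _⊑_ L R G → ∀ i → L i ⧏ G
Brace⇒left⧏ (plain _)                 = left⧏ _
Brace⇒left⧏ (collapse _ (L⧏n , _) _) = L⧏n

Brace⇒⧏right : ∀ {_⊑_ a b} {L : Fin a → PG} {R : Fin b → PG} {G} → Brace _⊑_ L R G → ∀ j → G ⧏ R j
Brace⇒⧏right (plain _)                 = ⧏right _
Brace⇒⧏right (collapse _ (_ , n⧏R) _) = n⧏R

data FirstSuch (p : ℤ → Bool) (F : ℕ → ℤ) (N : ℕ) : Maybe ℤ → Set where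
  none  : (∀ k → k ℕ.< N → ¬ T (p (F k))) → FirstSuch p F N nothing
  found : ∀ k → T (p (F k)) → (∀ k′ → k′ ℕ.< k → ¬ T (p (F k′))) → FirstSuch p F N (just (F k))

firstSuch-applyUpTo : ∀ p F N → FirstSuch p F N (firstSuch p (applyUpTo F N))
firstSuch-applyUpTo p F zero = none (λ _ ())
firstSuch-applyUpTo p F (suc N) with p (F 0) in p₀
... | true  = found 0 (subst T (sym p₀) _) (λ _ ())
... | false with firstSuch p (applyUpTo (F ∘ suc) N) | firstSuch-applyUpTo p (F ∘ suc) N
...   | _ | none ¬p      = none λ { zero _ → subst T p₀ ; (suc k) (s≤s k<N) → ¬p k k<N }
...   | _ | found k pk ¬p = found (suc k) pk λ { zero _ → subst T p₀ ; (suc k′) (s≤s k′<k) → ¬p k′ k′<k }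

firstSuch-Brace : ∀ {a b} (L : Fin a → PG) (R : Fin b → PG) (_⊑_ : ℤ → ℤ → Set) (F : ℕ → ℤ) N →
  (∀ {k k′} → k ℕ.≤ k′ → F k′ ⊑ F k) →
  (∀ {m} → Between L R m → ∃ λ k → k ℕ.< N × F k ≡ m) →
  Brace _⊑_ L R (orGame (firstSuch (between a L b R) (applyUpTo F N)) (mk a L b R))
firstSuch-Brace {a} {b} L R _⊑_ F N F-anti F-covers
  with firstSuch (between a L b R) (applyUpTo F N) | firstSuch-applyUpTo (between a L b R) F N
... | _ | none ¬inBetween = plain λ m m∈ →
  let k , k<N , Fk≡m = F-covers m∈ in
  ¬inBetween k k<N (subst (T ∘ between a L b R) (sym Fk≡m) (between⁺ L R m∈))
... | _ | found k Fk∈ earlier∉ = collapse (F k) (between⁻ L R Fk∈) λ m m∈ →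
  let k′ , _ , Fk′≡m = F-covers m∈ in
  subst (_⊑ F k) Fk′≡m (F-anti (k≤ k′ (subst (T ∘ between a L b R) (sym Fk′≡m) (between⁺ L R m∈))))
  where
  k≤ : ∀ k′ → T (between a L b R (F k′)) → k ℕ.≤ k′
  k≤ k′ Fk′∈ with k′ ℕ.<? k
  ... | yes k′<k = ⊥-elim (earlier∉ k′ k′<k Fk′∈)
  ... | no  k′≮k = ℕ.≮⇒≥ k′≮k

bounded-nonneg⇒index : ∀ {d} B → + 0 ℤ.≤ d → d ℤ.≤ + B + + B → ∃ λ k → k ℕ.< suc (2 * B) × + k ≡ d
bounded-nonneg⇒index B (+≤+ {n = k} _) (+≤+ k≤B+B) =
  k , s≤s (subst (k ℕ.≤_) (cong (B ℕ.+_) (sym (ℕ.+-identityʳ B))) k≤B+B) , refl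

descending-covers : ∀ B {m} → - + B ℤ.≤ m → m ℤ.≤ + B → ∃ λ k → k ℕ.< suc (2 * B) × + B - + k ≡ m
descending-covers B {m} -B≤m m≤B =
  let k , k<N , k≡B-m = bounded-nonneg⇒index B (ℤ.i≤j⇒0≤j-i m≤B) (ℤ.+-monoʳ-≤ (+ B) -m≤B) in
  k , k<N , trans (cong (λ x → + B - x) k≡B-m) (B-[B-m]≡m (+ B) m)
  where
  -m≤B : - m ℤ.≤ + B
  -m≤B = subst (- m ℤ.≤_) (ℤ.neg-involutive (+ B)) (ℤ.neg-mono-≤ -B≤m)
  B-[B-m]≡m : ∀ b m → b - (b - m) ≡ m
  B-[B-m]≡m = solve-∀

ascending-covers : ∀ B {m} → - + B ℤ.≤ m → m ℤ.≤ + B → ∃ λ k → k ℕ.< suc (2 * B) × - + B + + k ≡ m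
ascending-covers B {m} -B≤m m≤B =
  let k , k<N , k≡m+B = bounded-nonneg⇒index B 0≤m+B (ℤ.+-monoˡ-≤ (+ B) m≤B) in
  k , k<N , trans (cong (λ x → - + B + x) k≡m+B) (-B+[m+B]≡m (+ B) m)
  where
  0≤m+B : + 0 ℤ.≤ m + + B
  0≤m+B = subst (ℤ._≤ m + + B) (ℤ.+-inverseˡ (+ B)) (ℤ.+-monoˡ-≤ (+ B) -B≤m)
  -B+[m+B]≡m : ∀ b m → - b + (m + b) ≡ m
  -B+[m+B]≡m = solve-∀

brace⁺-spec : ∀ {a b} (L : Fin (suc a) → PG) (R : Fin (suc b) → PG) →
              Brace ℤ._≤_ L R (brace⁺ (suc a) L (suc b) R)
brace⁺-spec {a} {b} L R =
  subst (λ xs → Brace ℤ._≤_ L R (orGame (firstSuch (between (suc a) L (suc b) R) xs) (mk (suc a) L (suc b) R)))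
        (sym (map-applyUpTo id F (suc (2 * B))))
        (firstSuch-Brace L R ℤ._≤_ F (suc (2 * B))
          (λ k≤k′ → ℤ.+-monoʳ-≤ (+ B) (ℤ.neg-mono-≤ (+≤+ k≤k′)))
          (λ m∈ → let lo , hi = Between⇒bounded L R m∈ in descending-covers B lo hi))
  where
  B : ℕ
  B = optBound (suc a) L (suc b) R
  F : ℕ → ℤ
  F k = + B - + k

brace⁻-spec : ∀ {a b} (L : Fin (suc a) → PG) (R : Fin (suc b) → PG) →
              Brace ℤ._≥_ L R (brace⁻ (suc a) L (suc b) R)
brace⁻-spec {a} {b} L R =
  subst (λ xs → Brace ℤ._≥_ L R (orGame (firstSuch (between (suc a) L (suc b) R) xs) (mk (suc a) L (suc b) R)))
        (sym (map-applyUpTo id F (suc (2 * B))))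
        (firstSuch-Brace L R ℤ._≥_ F (suc (2 * B))
          (λ k≤k′ → ℤ.+-monoʳ-≤ (- + B) (+≤+ k≤k′))
          (λ m∈ → let lo , hi = Between⇒bounded L R m∈ in ascending-covers B lo hi))
  where
  B : ℕ
  B = optBound (suc a) L (suc b) R
  F : ℕ → ℤ
  F k = - + B + + k

-- Games with no integer between their options

-- Cross from k ≤ X to k + 1 ≰ X: then X ⧏ k + 1, and X ≤ k is excluded, so
-- some Xᴿ ≤ k + 1 ≤ X + 1.  Dually for the left options.
module _ {a b} {L : Fin a → PG} {R : Fin b → PG} (noInteger : NoIntegerBetween L R) where
  private
    X : PG
    X = mk a L b R
    r : ℕ
    r = rank X
    open Relation.Binary.Reasoning.PartialOrder ≤-poset

  noIntegerBetween⇒≉intᵖ : ∀ {k} → intᵖ k ≤ X → X ≤ intᵖ k → ⊥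
  noIntegerBetween⇒≉intᵖ k≤X X≤k =
    noInteger _ ((λ i → ⧏-≤-trans (left⧏ X i) X≤k) , (λ j → ≤-⧏-trans k≤X (⧏right X j)))

  noIntegerBetween⇒right≤+1 : ∃ λ j → R j ≤ X +ᵖ oneᵖ
  noIntegerBetween⇒right≤+1
    with ℤ-crossing (λ k → intᵖ k ≤ X) (λ k → intᵖ k ≤? X) (ℤ.neg-≤-pos {r} {suc r})
                    (intᵖ-neg-rank≤ X) (⧏⇒≱ (≤-⧏-trans (≤intᵖ-rank X) (intᵖ-⧏-suc (+ r))))
  ... | k , k≤X , 1+k≰X with ⧏-elim (≱⇒⧏ 1+k≰X)
  ...   | inj₁ (i , X≤[1+k]ᴸ) = ⊥-elim (noIntegerBetween⇒≉intᵖ k≤X X≤k)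
    where
    X≤k : X ≤ intᵖ k
    X≤k = subst (X ≤_) (trans (left-intᵖ (sucℤ k) i) (cong intᵖ (ℤ.pred-suc k))) X≤[1+k]ᴸ
  ...   | inj₂ (j , Xᴿ≤1+k) = j , (begin
    R j             ≤⟨ Xᴿ≤1+k ⟩
    intᵖ (sucℤ k)   ≈⟨ intᵖ-+1 k ⟨
    intᵖ k +ᵖ oneᵖ  ≤⟨ +ᵖ-monoˡ-≤ (oneᵖ) k≤X ⟩
    X +ᵖ oneᵖ       ∎)

  noIntegerBetween⇒≤left+1 : ∃ λ i → X ≤ L i +ᵖ oneᵖ
  noIntegerBetween⇒≤left+1
    with ℤ-crossing (λ k → ¬ X ≤ intᵖ k) (λ k → ¬? (X ≤? intᵖ k)) (ℤ.-≤+ {r} {r})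
                    (⧏⇒≱ (⧏-≤-trans (intᵖ-mono-< (ℤ.neg-mono-< (+<+ (ℕ.n<1+n r)))) (intᵖ-neg-rank≤ X)))
                    (λ X≰r → X≰r (≤intᵖ-rank X))
  ... | k , X≰k , ¬X≰1+k with ⧏-elim (≱⇒⧏ X≰k)
  ...   | inj₁ (i , k≤Xᴸ) = i , (begin
    X               ≤⟨ X≤1+k ⟩
    intᵖ (sucℤ k)   ≈⟨ intᵖ-+1 k ⟨
    intᵖ k +ᵖ oneᵖ  ≤⟨ +ᵖ-monoˡ-≤ (oneᵖ) k≤Xᴸ ⟩
    L i +ᵖ oneᵖ     ∎)
    where
    X≤1+k : X ≤ intᵖ (sucℤ k)
    X≤1+k = decidable-stable (X ≤? intᵖ (sucℤ k)) ¬X≰1+k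
  ...   | inj₂ (j , kᴿ≤X) = ⊥-elim (noIntegerBetween⇒≉intᵖ 1+k≤X X≤1+k)
    where
    X≤1+k : X ≤ intᵖ (sucℤ k)
    X≤1+k = decidable-stable (X ≤? intᵖ (sucℤ k)) ¬X≰1+k
    1+k≤X : intᵖ (sucℤ k) ≤ X
    1+k≤X = subst (_≤ X) (right-intᵖ k j) kᴿ≤X

-- The options (m ± 1) + B contributed by the integer are dominated by options
-- m + Bᴸ and m + Bᴿ, using B ≤ Bᴸ + 1 and Bᴿ ≤ B + 1.
intᵖ-translation : ∀ m {c d} {BL : Fin c → PG} {BR : Fin d → PG} → NoIntegerBetween BL BR →
  ∀ {a b} {SL : Fin a → PG} {SR : Fin b → PG} →
  (∀ k → SL k ⧏ intᵖ m +ᵖ mk c BL d BR) → (∀ k → intᵖ m +ᵖ mk c BL d BR ⧏ SR k) →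
  (∀ i → ∃ λ k → SL k ≈ intᵖ m +ᵖ BL i) → (∀ j → ∃ λ k → SR k ≈ intᵖ m +ᵖ BR j) →
  mk a SL b SR ≈ intᵖ m +ᵖ mk c BL d BR
intᵖ-translation m {c} {d} {BL} {BR} noInteger {a} {b} {SL} {SR} SL⧏ ⧏SR SL∋ SR∋ =
  ≤-intro SL⧏ (right-+ᵖ-∀ {S ⧏_} M B S⧏Mᴿ+B S⧏M+Bᴿ) ,
  ≤-intro (left-+ᵖ-∀ {_⧏ S} M B Mᴸ+B⧏S M+Bᴸ⧏S) ⧏SR
  where
  S M B : PG
  S = mk a SL b SR
  M = intᵖ m
  B = mk c BL d BR
  open Relation.Binary.Reasoning.PartialOrder ≤-poset
  S⧏M+Bᴿ : ∀ j → S ⧏ M +ᵖ BR j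
  S⧏M+Bᴿ j = let k , SRk≈ = SR∋ j in ⧏-≤-trans (⧏right S k) (proj₁ SRk≈)
  M+Bᴸ⧏S : ∀ i → M +ᵖ BL i ⧏ S
  M+Bᴸ⧏S i = let k , SLk≈ = SL∋ i in ≤-⧏-trans (proj₂ SLk≈) (left⧏ S k)
  S⧏Mᴿ+B : ∀ j → S ⧏ right M j +ᵖ B
  S⧏Mᴿ+B j = let j′ , BRj′≤B+1 = noIntegerBetween⇒right≤+1 noInteger in
    ⧏-≤-trans (S⧏M+Bᴿ j′) (begin
      M +ᵖ BR j′          ≤⟨ +ᵖ-monoʳ-≤ M BRj′≤B+1 ⟩
      M +ᵖ (B +ᵖ oneᵖ)    ≈⟨ x∙yz≈xz∙y M B oneᵖ ⟩
      (M +ᵖ oneᵖ) +ᵖ B    ≈⟨ +ᵖ-cong (intᵖ-+1 m) ≈-refl ⟩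
      intᵖ (sucℤ m) +ᵖ B  ≡⟨ cong (_+ᵖ B) (right-intᵖ m j) ⟨
      right M j +ᵖ B      ∎)
  Mᴸ+B⧏S : ∀ i → left M i +ᵖ B ⧏ S
  Mᴸ+B⧏S i = let i′ , B≤BLi′+1 = noIntegerBetween⇒≤left+1 noInteger in
    ≤-⧏-trans (begin
      left M i +ᵖ B                     ≡⟨ cong (_+ᵖ B) (left-intᵖ m i) ⟩
      intᵖ (pred m) +ᵖ B                ≤⟨ +ᵖ-monoʳ-≤ (intᵖ (pred m)) B≤BLi′+1 ⟩
      intᵖ (pred m) +ᵖ (BL i′ +ᵖ oneᵖ)  ≈⟨ x∙yz≈xz∙y (intᵖ (pred m)) (BL i′) oneᵖ ⟩
      (intᵖ (pred m) +ᵖ oneᵖ) +ᵖ BL i′  ≈⟨ +ᵖ-cong (intᵖ-+1 (pred m)) ≈-refl ⟩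
      intᵖ (sucℤ (pred m)) +ᵖ BL i′     ≡⟨ cong (λ n → intᵖ n +ᵖ BL i′) (ℤ.suc-pred m) ⟩
      M +ᵖ BL i′                        ∎)
      (M+Bᴸ⧏S i′)

noIntegerBetween-+ᵖ : ∀ {a b c d} {AL : Fin a → PG} {AR : Fin b → PG} {BL : Fin c → PG} {BR : Fin d → PG} →
  NoIntegerBetween AL AR → NoIntegerBetween BL BR →
  ∀ {m} → Between (left (mk a AL b AR +ᵖ mk c BL d BR)) (right (mk a AL b AR +ᵖ mk c BL d BR)) m →
  mk a AL b AR +ᵖ mk c BL d BR ≈ intᵖ m
noIntegerBetween-+ᵖ {a} {b} {c} {d} {AL} {AR} {BL} {BR} noIntegerA noIntegerB {m} (Xᴸ⧏m , m⧏Xᴿ) =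
  ≤-intro Xᴸ⧏m (λ j → subst (X ⧏_) (sym (right-intᵖ m j)) (≱⇒⧏ 1+m≰X)) ,
  ≤-intro (λ i → subst (_⧏ X) (sym (left-intᵖ m i)) (≱⇒⧏ X≰m-1)) m⧏Xᴿ
  where
  A B X : PG
  A = mk a AL b AR
  B = mk c BL d BR
  X = A +ᵖ B
  open Relation.Binary.Reasoning.PartialOrder ≤-poset
  A+BL⧏m : ∀ i → A +ᵖ BL i ⧏ intᵖ m
  A+BL⧏m i = let k , Xᴸk≡A+BLi = left-+ᵖʳ A B i in subst (_⧏ intᵖ m) Xᴸk≡A+BLi (Xᴸ⧏m k)
  m⧏AR+B : ∀ j → intᵖ m ⧏ AR j +ᵖ B
  m⧏AR+B j = let k , Xᴿk≡ARj+B = right-+ᵖˡ A B j in subst (intᵖ m ⧏_) Xᴿk≡ARj+B (m⧏Xᴿ k)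
  1+m≰X : ¬ intᵖ (sucℤ m) ≤ X
  1+m≰X 1+m≤X =
    let i , B≤BLi+1 = noIntegerBetween⇒≤left+1 noIntegerB in
    ⧏⇒≱ (A+BL⧏m i) (intᵖ-+ᵖ-cancelˡ-≤ (+ 1) (begin
      oneᵖ +ᵖ intᵖ m       ≈⟨ intᵖ-1+ m ⟩
      intᵖ (sucℤ m)        ≤⟨ 1+m≤X ⟩
      A +ᵖ B               ≤⟨ +ᵖ-monoʳ-≤ A B≤BLi+1 ⟩
      A +ᵖ (BL i +ᵖ oneᵖ)  ≈⟨ x∙yz≈z∙xy A (BL i) oneᵖ ⟩
      oneᵖ +ᵖ (A +ᵖ BL i)  ∎))
  X≰m-1 : ¬ X ≤ intᵖ (pred m)
  X≰m-1 X≤m-1 =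
    let j , ARj≤A+1 = noIntegerBetween⇒right≤+1 noIntegerA in
    ⧏⇒≱ (m⧏AR+B j) (begin
      AR j +ᵖ B              ≤⟨ +ᵖ-monoˡ-≤ B ARj≤A+1 ⟩
      (A +ᵖ oneᵖ) +ᵖ B       ≈⟨ xy∙z≈y∙xz A oneᵖ B ⟩
      oneᵖ +ᵖ (A +ᵖ B)       ≤⟨ +ᵖ-monoʳ-≤ oneᵖ X≤m-1 ⟩
      oneᵖ +ᵖ intᵖ (pred m)  ≈⟨ intᵖ-1+ (pred m) ⟩
      intᵖ (sucℤ (pred m))   ≡⟨ cong intᵖ (ℤ.suc-pred m) ⟩
      intᵖ m                 ∎)

-- Sums of braces

data Nonempty : SG → Set where
  num : ∀ n → Nonempty (num n)
  opt : ∀ a b (L : Fin (suc a) → SG) (R : Fin (suc b) → SG) →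
        (∀ i → Nonempty (L i)) → (∀ j → Nonempty (R j)) → Nonempty (opt (suc a) L (suc b) R)

mutual
  evenTempered⇒nonempty : ∀ {G} → EvenT G → Nonempty G
  evenTempered⇒nonempty (evNum n)               = num n
  evenTempered⇒nonempty (evOpt a b L R oddL oddR) =
    opt a b L R (oddTempered⇒nonempty ∘ oddL) (oddTempered⇒nonempty ∘ oddR)

  oddTempered⇒nonempty : ∀ {G} → OddT G → Nonempty G
  oddTempered⇒nonempty (odOpt a b L R evenL evenR) =
    opt a b L R (evenTempered⇒nonempty ∘ evenL) (evenTempered⇒nonempty ∘ evenR)

wellTempered⇒nonempty : ∀ {G} → WellTempered G → Nonempty G
wellTempered⇒nonempty (even e) = evenTempered⇒nonempty e
wellTempered⇒nonempty (odd o)  = oddTempered⇒nonempty o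

module BraceSum (_⊑_ : ℤ → ℤ → Set) (⊑-antisym : ∀ {x y} → x ⊑ y → y ⊑ x → x ≡ y)
         (⊑-+-monoʳ : ∀ c {x y} → x ⊑ y → (c + x) ⊑ (c + y)) where

  extremal-+ : ∀ {m y s} → (s - m) ⊑ y → (m + y) ⊑ s → s ≡ m + y
  extremal-+ {m} {y} {s} s-m⊑y m+y⊑s =
    ⊑-antisym (subst (_⊑ (m + y)) (m+[n-m]≡n m s) (⊑-+-monoʳ m s-m⊑y)) m+y⊑s

  Brace-intᵖ-+ᵖ : ∀ m {c d} {BL : Fin c → PG} {BR : Fin d → PG} {B} → Brace _⊑_ BL BR B →
    ∀ {SL : Fin c → PG} {SR : Fin d → PG} {S} → Brace _⊑_ SL SR S →
    (∀ i → SL i ≈ intᵖ m +ᵖ BL i) → (∀ j → SR j ≈ intᵖ m +ᵖ BR j) →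
    S ≈ intᵖ m +ᵖ B
  Brace-intᵖ-+ᵖ m {BL = BL} {BR} {B} braceB {SL} {SR} {S} braceS SL≈ SR≈ = cases braceB braceS
    where
    SL⧏m+B : ∀ i → SL i ⧏ intᵖ m +ᵖ B
    SL⧏m+B i = ≤-⧏-trans (proj₁ (SL≈ i)) (+ᵖ-monoʳ-⧏ (intᵖ m) (Brace⇒left⧏ braceB i))
    m+B⧏SR : ∀ j → intᵖ m +ᵖ B ⧏ SR j
    m+B⧏SR j = ⧏-≤-trans (+ᵖ-monoʳ-⧏ (intᵖ m) (Brace⇒⧏right braceB j)) (proj₂ (SR≈ j))
    cases : Brace _⊑_ BL BR B → Brace _⊑_ SL SR S → S ≈ intᵖ m +ᵖ B
    cases (plain noB) (plain _) =
      intᵖ-translation m noB SL⧏m+B m+B⧏SR (λ i → i , SL≈ i) (λ j → j , SR≈ j)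
    cases (plain noB) (collapse s s∈ _) = ⊥-elim (noB (s - m) (Between-unshift m SL≈ SR≈ s∈))
    cases (collapse y _ _) (plain noS) =
      ⊥-elim (noS (m + y) (Between-≈intᵖ SL⧏m+B m+B⧏SR (intᵖ-homo-+ m y)))
    cases (collapse y _ y-max) (collapse s s∈ s-max) = begin-equality
      intᵖ s            ≡⟨ cong intᵖ s≡m+y ⟩
      intᵖ (m + y)      ≈⟨ intᵖ-homo-+ m y ⟨
      intᵖ m +ᵖ intᵖ y  ∎
      where
      open Relation.Binary.Reasoning.PartialOrder ≤-poset
      s≡m+y : s ≡ m + y
      s≡m+y = extremal-+ (y-max (s - m) (Between-unshift m SL≈ SR≈ s∈))
                         (s-max (m + y) (Between-≈intᵖ SL⧏m+B m+B⧏SR (intᵖ-homo-+ m y)))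

  Brace-+ᵖ : ∀ {a b c d} {AL : Fin a → PG} {AR : Fin b → PG} {BL : Fin c → PG} {BR : Fin d → PG} {A B} →
    Brace _⊑_ AL AR A → Brace _⊑_ BL BR B →
    ∀ {SL SR S} → Brace _⊑_ SL SR S →
    (∀ k → SL k ≈ concatF a c (λ i → AL i +ᵖ B) (λ i → A +ᵖ BL i) k) →
    (∀ k → SR k ≈ concatF b d (λ j → AR j +ᵖ B) (λ j → A +ᵖ BR j) k) →
    S ≈ A +ᵖ B
  Brace-+ᵖ {a} {b} {c} {d} {AL} {AR} {BL} {BR} {A} {B} braceA braceB {SL} {SR} {S} braceS SL≈ SR≈ =
    cases braceA braceB braceS
    where
    SLʳ : ∀ i → SL (a ↑ʳ i) ≈ A +ᵖ BL i
    SLʳ = ≋concatF⇒↑ʳ SL≈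
    SRʳ : ∀ j → SR (b ↑ʳ j) ≈ A +ᵖ BR j
    SRʳ = ≋concatF⇒↑ʳ SR≈
    SLˡ : ∀ i → SL (i ↑ˡ c) ≈ B +ᵖ AL i
    SLˡ i = ≈-trans (≋concatF⇒↑ˡ SL≈ i) (+ᵖ-comm _ _)
    SRˡ : ∀ j → SR (j ↑ˡ d) ≈ B +ᵖ AR j
    SRˡ j = ≈-trans (≋concatF⇒↑ˡ SR≈ j) (+ᵖ-comm _ _)
    SL⧏A+B : ∀ k → SL k ⧏ A +ᵖ B
    SL⧏A+B k = ≤-⧏-trans (proj₁ (SL≈ k)) (sum-left⧏ (Brace⇒left⧏ braceA) (Brace⇒left⧏ braceB) k)
    A+B⧏SR : ∀ k → A +ᵖ B ⧏ SR k
    A+B⧏SR k = ⧏-≤-trans (⧏sum-right (Brace⇒⧏right braceA) (Brace⇒⧏right braceB) k) (proj₂ (SR≈ k))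
    cases : Brace _⊑_ AL AR A → Brace _⊑_ BL BR B → Brace _⊑_ SL SR S → S ≈ A +ᵖ B
    cases (collapse x _ _) (collapse y _ _) (plain noS) =
      ⊥-elim (noS (x + y) (Between-≈intᵖ SL⧏A+B A+B⧏SR (intᵖ-homo-+ x y)))
    cases (collapse x _ _) (collapse y _ y-max) (collapse s s∈ s-max) = begin-equality
      intᵖ s            ≡⟨ cong intᵖ s≡x+y ⟩
      intᵖ (x + y)      ≈⟨ intᵖ-homo-+ x y ⟨
      intᵖ x +ᵖ intᵖ y  ∎
      where
      open Relation.Binary.Reasoning.PartialOrder ≤-poset
      s≡x+y : s ≡ x + y
      s≡x+y = extremal-+
        (y-max (s - x) (Between-unshift x SLʳ SRʳ (Between-reindex (a ↑ʳ_) (b ↑ʳ_) s∈)))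
        (s-max (x + y) (Between-≈intᵖ SL⧏A+B A+B⧏SR (intᵖ-homo-+ x y)))
    cases (collapse x _ _) (plain noB) (collapse s s∈ _) =
      ⊥-elim (noB (s - x) (Between-unshift x SLʳ SRʳ (Between-reindex (a ↑ʳ_) (b ↑ʳ_) s∈)))
    cases (collapse x _ _) (plain noB) (plain _) =
      intᵖ-translation x noB SL⧏A+B A+B⧏SR (λ i → a ↑ʳ i , SLʳ i) (λ j → b ↑ʳ j , SRʳ j)
    cases (plain noA) (collapse y _ _) (collapse s s∈ _) =
      ⊥-elim (noA (s - y) (Between-unshift y SLˡ SRˡ (Between-reindex (_↑ˡ c) (_↑ˡ d) s∈)))
    cases (plain noA) (collapse y _ _) (plain _) = ≈-trans
      (intᵖ-translation y noA (λ k → ⧏-≤-trans (SL⧏A+B k) (+ᵖ-comm-≤ A B))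
                              (λ k → ≤-⧏-trans (+ᵖ-comm-≤ B A) (A+B⧏SR k))
                              (λ i → i ↑ˡ c , SLˡ i) (λ j → j ↑ˡ d , SRˡ j))
      (+ᵖ-comm B A)
    cases (plain noA) (plain noB) (collapse m m∈ _) =
      ≈-sym (noIntegerBetween-+ᵖ noA noB (Between-resp-≋ SL≈ SR≈ m∈))
    cases (plain _) (plain _) (plain _) = mk-cong SL≈ SR≈

  module _ (ψ : SG → PG) (ψ-num : ∀ n → ψ (num n) ≡ intᵖ n)
           (ψ-opt : ∀ a b (L : Fin (suc a) → SG) (R : Fin (suc b) → SG) →
                    Brace _⊑_ (ψ ∘ L) (ψ ∘ R) (ψ (opt (suc a) L (suc b) R))) where

    ψ-num-≈ : ∀ n → ψ (num n) ≈ intᵖ n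
    ψ-num-≈ n = ≈-reflexive (ψ-num n)

    ψ-homo-+ : ∀ {G H} → Nonempty G → Nonempty H → ψ (G +ˢ H) ≈ ψ G +ᵖ ψ H
    ψ-homo-+ (num m) (num n) = begin-equality
      ψ (num (m + n))         ≈⟨ ψ-num-≈ (m + n) ⟩
      intᵖ (m + n)            ≈⟨ intᵖ-homo-+ m n ⟨
      intᵖ m +ᵖ intᵖ n        ≈⟨ +ᵖ-cong (ψ-num-≈ m) (ψ-num-≈ n) ⟨
      ψ (num m) +ᵖ ψ (num n)  ∎
      where open Relation.Binary.Reasoning.PartialOrder ≤-poset
    ψ-homo-+ neG@(num m) (opt c d L R neL neR) = ≈-trans
      (Brace-intᵖ-+ᵖ m (ψ-opt c d L R) (ψ-opt c d _ _)
        (λ i → ≈-trans (ψ-homo-+ neG (neL i)) (+ᵖ-cong (ψ-num-≈ m) ≈-refl))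
        (λ j → ≈-trans (ψ-homo-+ neG (neR j)) (+ᵖ-cong (ψ-num-≈ m) ≈-refl)))
      (+ᵖ-cong (≈-sym (ψ-num-≈ m)) ≈-refl)
    ψ-homo-+ (opt a b L R neL neR) neH@(num n) = ≈-trans
      (Brace-intᵖ-+ᵖ n (ψ-opt a b L R) (ψ-opt a b _ _)
        (λ i → ≈-trans (ψ-homo-+ (neL i) neH) (≈-trans (+ᵖ-cong ≈-refl (ψ-num-≈ n)) (+ᵖ-comm _ _)))
        (λ j → ≈-trans (ψ-homo-+ (neR j) neH) (≈-trans (+ᵖ-cong ≈-refl (ψ-num-≈ n)) (+ᵖ-comm _ _))))
      (≈-trans (+ᵖ-comm _ _) (+ᵖ-cong ≈-refl (≈-sym (ψ-num-≈ n))))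
    ψ-homo-+ neG@(opt a b L R neL neR) neH@(opt c d L′ R′ neL′ neR′) =
      Brace-+ᵖ (ψ-opt a b L R) (ψ-opt c d L′ R′) (ψ-opt _ _ _ _)
        (concatF-map-≈ ψ (suc a) (suc c) (λ i → ψ-homo-+ (neL i) neH) (λ i → ψ-homo-+ neG (neL′ i)))
        (concatF-map-≈ ψ (suc b) (suc d) (λ j → ψ-homo-+ (neR j) neH) (λ j → ψ-homo-+ neG (neR′ j)))

mainTheorem15 : (G H : SG) → WellTempered G → WellTempered H →
                (ψ⁺ (G +ˢ H) ≈ᵖ (ψ⁺ G +ᵖ ψ⁺ H)) × (ψ⁻ (G +ˢ H) ≈ᵖ (ψ⁻ G +ᵖ ψ⁻ H))
mainTheorem15 G H wtG wtH =
  ≈⇒≈ᵖ (BraceSum.ψ-homo-+ ℤ._≤_ ℤ.≤-antisym ℤ.+-monoʳ-≤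
          ψ⁺ (λ _ → refl) (λ _ _ L R → brace⁺-spec (ψ⁺ ∘ L) (ψ⁺ ∘ R)) neG neH) ,
  ≈⇒≈ᵖ (BraceSum.ψ-homo-+ ℤ._≥_ (flip ℤ.≤-antisym) (λ c → ℤ.+-monoʳ-≤ c)
          ψ⁻ (λ _ → refl) (λ _ _ L R → brace⁻-spec (ψ⁻ ∘ L) (ψ⁻ ∘ R)) neG neH)
  where
  neG : Nonempty G
  neG = wellTempered⇒nonempty wtG
  neH : Nonempty H
  neH = wellTempered⇒nonempty wtH
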